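{- Let $1\le\delta<\Delta$ be integers, $\tilde h:\mathbb{Z}^+\to\mathbb{R}^+$ a positive non-increasing function and $\mathcal{J}(G)=\sum_{u\in V(G)}\tilde h(d_u)$. Then $H_{\delta,\Delta}$ is minimal for $\mathcal{J}$ on $\mathfrak{G}^{\Delta+1}_{\delta,\Delta}$, i.e. $\mathcal{J}(H_{\delta,\Delta})\le\mathcal{J}(G)$ for all $G\in\mathfrak{G}^{\Delta+1}_{\delta,\Delta}$. Moreover, if $\tilde h(\Delta-2)>\tilde h(\Delta-1)>\tilde h(\Delta)$, then $G\in\mathfrak{G}^{\Delta+1}_{\delta,\Delta}$ is minimal for $\mathcal{J}$ on $\mathfrak{G}^{\Delta+1}_{\delta,\Delta}$ if and only if $G$ is (isomorphic to) $H_{\delta,\Delta}$.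
   Context: All graphs are finite and simple; $d_u$ is the degree of $u$. $\mathfrak{G}^n_{\delta,\Delta}$ is the family of graphs with $n$ vertices, minimum degree $\delta$ and maximum degree $\Delta$. $H_{\delta,\Delta}$ is the graph obtained from a complete graph on vertices $v_1,\dots,v_\Delta$ by adding a vertex $w$ and the edges $v_iw$ for $1\le i\le\delta$. A graph $G$ in a family $\mathcal{F}$ is minimal for $\mathcal{J}$ on $\mathcal{F}$ if $\mathcal{J}(G)\le\mathcal{J}(\Gamma)$ for all $\Gamma\in\mathcal{F}$. -}

module Defs where

open import Level using (Level; suc; _⊔_)
open import Data.Nat as ℕ using (ℕ; zero; _≡ᵇ_; _<ᵇ_)
open import Data.Bool using (Bool; true; false; not; _∧_; _∨_)
open import Data.Bool.Properties using (∧-comm; ∨-comm)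
open import Data.Fin using (Fin; toℕ)
open import Data.List using (List; []; _∷_; foldr; map)
open import Data.List using (allFin)
open import Data.Sum using (_⊎_)
open import Data.Product using (Σ; _×_; ∃; _,_)
open import Function.Bundles using (_↔_; Inverse)
open import Relation.Binary.PropositionalEquality using (_≡_; _≢_; refl; cong; cong₂)

record OrderedAbelianGroup (c ℓ : Level) : Set (Level.suc (c ⊔ ℓ)) where
  infixl 6 _+_
  infix 4 _≤_ _<_
  field
    Carrier  : Set c
    _+_      : Carrier → Carrier → Carrier
    0#       : Carrier
    -_       : Carrier → Carrier
    _≤_      : Carrier → Carrier → Set ℓ
    +-assoc  : ∀ x y z → (x + y) + z ≡ x + (y + z)
    +-comm   : ∀ x y → x + y ≡ y + x
    +-identityˡ : ∀ x → 0# + x ≡ x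
    -‿inverseˡ  : ∀ x → (- x) + x ≡ 0#
    ≤-refl   : ∀ {x} → x ≤ x
    ≤-trans  : ∀ {x y z} → x ≤ y → y ≤ z → x ≤ z
    ≤-antisym : ∀ {x y} → x ≤ y → y ≤ x → x ≡ y
    ≤-total  : ∀ x y → (x ≤ y) ⊎ (y ≤ x)
    +-monoˡ-≤ : ∀ {x y} z → x ≤ y → x + z ≤ y + z

  _<_ : Carrier → Carrier → Set (c ⊔ ℓ)
  x < y = (x ≤ y) × (x ≢ y)

  sumL : List Carrier → Carrier
  sumL = foldr _+_ 0#

record Graph (n : ℕ) : Set where
  field
    adj   : Fin n → Fin n → Bool
    sym   : ∀ i j → adj i j ≡ adj j i
    irrefl : ∀ i → adj i i ≡ false

open Graph public

count : {A : Set} → (A → Bool) → List A → ℕ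
count p [] = 0
count p (x ∷ xs) with p x
... | true  = ℕ.suc (count p xs)
... | false = count p xs

degree : {n : ℕ} → Graph n → Fin n → ℕ
degree G u = count (adj G u) (allFin _)

InFamily : (n δ Δ : ℕ) → Graph n → Set
InFamily n δ Δ G =
  (∀ u → δ ℕ.≤ degree G u) × (∃ λ u → degree G u ≡ δ) ×
  (∀ u → degree G u ℕ.≤ Δ) × (∃ λ u → degree G u ≡ Δ)

_≅_ : {n : ℕ} → Graph n → Graph n → Set
_≅_ {n} G H = Σ (Fin n ↔ Fin n) λ f →
  ∀ i j → adj G i j ≡ adj H (Inverse.to f i) (Inverse.to f j)

-- H_{δ,Δ} on Fin (Δ+1): vertex with index i < Δ is v_{i+1}, index Δ is w.

private
  ≡ᵇ-sym : ∀ a b → (a ≡ᵇ b) ≡ (b ≡ᵇ a)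
  ≡ᵇ-sym zero zero = refl
  ≡ᵇ-sym zero (ℕ.suc b) = refl
  ≡ᵇ-sym (ℕ.suc a) zero = refl
  ≡ᵇ-sym (ℕ.suc a) (ℕ.suc b) = ≡ᵇ-sym a b

  ≡ᵇ-refl : ∀ a → (a ≡ᵇ a) ≡ true
  ≡ᵇ-refl zero = refl
  ≡ᵇ-refl (ℕ.suc a) = ≡ᵇ-refl a

adjH : (δ Δ : ℕ) → Fin (ℕ.suc Δ) → Fin (ℕ.suc Δ) → Bool
adjH δ Δ i j = not (toℕ i ≡ᵇ toℕ j) ∧
  ((((toℕ i <ᵇ Δ) ∧ (toℕ j <ᵇ Δ)) ∨ ((toℕ i ≡ᵇ Δ) ∧ (toℕ j <ᵇ δ)))
     ∨ ((toℕ j ≡ᵇ Δ) ∧ (toℕ i <ᵇ δ)))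

private
  adjH-sym : ∀ δ Δ i j → adjH δ Δ i j ≡ adjH δ Δ j i
  adjH-sym δ Δ i j =
    cong₂ (λ x y → not x ∧ y) (≡ᵇ-sym (toℕ i) (toℕ j))
      (lemma (toℕ i <ᵇ Δ) (toℕ j <ᵇ Δ) _ _)
    where
    lemma : ∀ a b x y → ((a ∧ b) ∨ x) ∨ y ≡ ((b ∧ a) ∨ y) ∨ x
    lemma false false false false = refl
    lemma false false false true = refl
    lemma false false true false = refl
    lemma false false true true = refl
    lemma false true false false = refl
    lemma false true false true = refl
    lemma false true true false = refl
    lemma false true true true = refl
    lemma true false false false = refl
    lemma true false false true = refl
    lemma true false true false = refl
    lemma true false true true = refl
    lemma true true x y = refl

  adjH-irrefl : ∀ δ Δ i → adjH δ Δ i i ≡ false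
  adjH-irrefl δ Δ i rewrite ≡ᵇ-refl (toℕ i) = refl

H : (δ Δ : ℕ) → Graph (ℕ.suc Δ)
H δ Δ = record { adj = adjH δ Δ ; sym = adjH-sym δ Δ ; irrefl = adjH-irrefl δ Δ }

𝒥 : ∀ {c ℓ} (R : OrderedAbelianGroup c ℓ) → (ℕ → OrderedAbelianGroup.Carrier R) →
    {n : ℕ} → Graph n → OrderedAbelianGroup.Carrier R
𝒥 R h G = OrderedAbelianGroup.sumL R (map (λ u → h (degree G u)) (allFin _))

IsMinimal : ∀ {c ℓ} (R : OrderedAbelianGroup c ℓ) → (ℕ → OrderedAbelianGroup.Carrier R) →
            (n δ Δ : ℕ) → Graph n → Set ℓ
IsMinimal R h n δ Δ G = InFamily n δ Δ G ×
  (∀ Γ → InFamily n δ Δ Γ → OrderedAbelianGroup._≤_ R (𝒥 R h G) (𝒥 R h Γ))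

{-# OPTIONS --safe #-}
module Submission where

-- Let w be a vertex of minimum degree δ in G ∈ 𝔊^{Δ+1}_{δ,Δ}. Every other vertex has degree at
-- most Δ, and at most Δ - 1 if it is not adjacent to w, because it then misses both itself and w.
-- Relabelling G so that w and its neighbourhood sit where they sit in H_{δ,Δ}, whose degrees attain
-- these bounds, gives d_G(ρ i) ≤ d_H(i) for every vertex i, hence 𝒥(H) ≤ 𝒥(G) as h̃ is
-- non-increasing. If 𝒥(G) = 𝒥(H), the strict drops of h̃ below Δ and Δ - 1 turn all these
-- inequalities into equalities, and then a missing edge between two vertices other than w would
-- leave one of them with too few neighbours: G - w is complete and the relabelling is an
-- isomorphism onto H_{δ,Δ}.

open import Defs
open import Data.Nat using (ℕ; suc; _∸_) renaming (_≤_ to _≤ℕ_; _<_ to _<ℕ_)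
open import Data.Product using (_×_; _,_)
open import Function.Bundles using (_⇔_)

module Counting where
  open import Data.Nat using (zero; _+_; _≤_; _<_; z≤n; s≤s; _<ᵇ_)
  open import Data.Nat.Properties as ℕ using (+-0-commutativeMonoid; +-commutativeSemigroup)
  open import Algebra.Properties.CommutativeSemigroup +-commutativeSemigroup using (interchange)
  open import Data.Bool using (Bool; true; false)
  open import Data.Fin using (Fin; toℕ; fromℕ; fromℕ<) renaming (zero to 0F; suc to sucF)
  open import Data.Fin.Properties using (_≟_; toℕ-injective; toℕ-fromℕ; toℕ-fromℕ<; toℕ≤pred[n])
  open import Data.Fin.Permutation as Perm using (Permutation; _⟨$⟩ʳ_; _⟨$⟩ˡ_; _∘ₚ_; transpose; lift₀)
  open import Data.List using (List; []; _∷_; length)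
  open import Data.List.Membership.Propositional using (_∈_; _∉_)
  open import Data.List.Relation.Unary.All as All using (All)
  open import Data.List.Relation.Unary.All.Properties using (All¬⇒¬Any)
  open import Data.List.Relation.Unary.Any using (here; there; any?)
  open import Data.List.Relation.Unary.AllPairs using ([]; _∷_)
  open import Data.List.Relation.Unary.Unique.Propositional using (Unique)
  open import Data.Product using (Σ-syntax; proj₁; proj₂)
  open import Data.Empty using (⊥-elim)
  open import Relation.Nullary using (Dec; does; yes; no)
  open import Relation.Nullary.Decidable using (dec-true; dec-false)
  open import Relation.Binary.PropositionalEquality as ≡ using (_≡_; _≢_; refl; trans; cong; cong₂; subst; module ≡-Reasoning)
  import Algebra.Properties.CommutativeMonoid.Sum as CommutativeMonoidSum

  open CommutativeMonoidSum +-0-commutativeMonoid public using (sum; sum-cong-≗; sum-permute; sum-replicate-zero)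

  [_] : Bool → ℕ
  [ true ] = 1
  [ false ] = 0

  [b]≤1 : ∀ b → [ b ] ≤ 1
  [b]≤1 true = s≤s z≤n
  [b]≤1 false = z≤n

  ∣_∣ : ∀ {n} → (Fin n → Bool) → ℕ
  ∣ b ∣ = sum (λ x → [ b x ])

  sum-mono-≤ : ∀ {n} {f g : Fin n → ℕ} → (∀ i → f i ≤ g i) → sum f ≤ sum g
  sum-mono-≤ {zero} f≤g = z≤n
  sum-mono-≤ {suc n} f≤g = ℕ.+-mono-≤ (f≤g 0F) (sum-mono-≤ (λ i → f≤g (sucF i)))

  sum-distrib-+ : ∀ {n} (f g : Fin n → ℕ) → sum (λ i → f i + g i) ≡ sum f + sum g
  sum-distrib-+ {zero} f g = refl
  sum-distrib-+ {suc n} f g =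
    trans (cong (f 0F + g 0F +_) (sum-distrib-+ (λ i → f (sucF i)) (λ i → g (sucF i))))
          (interchange (f 0F) (g 0F) _ _)

  sum-one : ∀ {n} → sum {n} (λ _ → 1) ≡ n
  sum-one {zero} = refl
  sum-one {suc n} = cong suc (sum-one {n})

  ∣b∣≤n : ∀ {n} (b : Fin n → Bool) → ∣ b ∣ ≤ n
  ∣b∣≤n b = subst (∣ b ∣ ≤_) sum-one (sum-mono-≤ (λ x → [b]≤1 (b x)))

  ∣<k∣≡k : ∀ {n} k → k ≤ n → ∣ (λ (x : Fin n) → toℕ x <ᵇ k) ∣ ≡ k
  ∣<k∣≡k {zero} zero _ = refl
  ∣<k∣≡k {suc n} zero _ = ∣<k∣≡k {n} zero z≤n
  ∣<k∣≡k {suc n} (suc k) (s≤s k≤n) = cong suc (∣<k∣≡k k k≤n)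

  ∣singleton∣≡1 : ∀ {n} (v : Fin n) → ∣ (λ x → does (x ≟ v)) ∣ ≡ 1
  ∣singleton∣≡1 {suc n} 0F = cong suc (∣none∣≡0 {n})
    where
    ∣none∣≡0 : ∀ {m} → ∣ (λ (x : Fin m) → does (sucF x ≟ 0F)) ∣ ≡ 0
    ∣none∣≡0 {zero} = refl
    ∣none∣≡0 {suc m} = ∣none∣≡0 {m}
  ∣singleton∣≡1 {suc n} (sucF v) = ∣singleton∣≡1 v

  occurrences : ∀ {n} → List (Fin n) → Fin n → ℕ
  occurrences [] x = 0
  occurrences (v ∷ vs) x = [ does (x ≟ v) ] + occurrences vs x

  sum-occurrences≡length : ∀ {n} (vs : List (Fin n)) → sum (occurrences vs) ≡ length vs
  sum-occurrences≡length {n} [] = sum-replicate-zero n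
  sum-occurrences≡length (v ∷ vs) =
    trans (sum-distrib-+ _ (occurrences vs)) (cong₂ _+_ (∣singleton∣≡1 v) (sum-occurrences≡length vs))

  occurrences-∉ : ∀ {n} {x : Fin n} {vs} → x ∉ vs → occurrences vs x ≡ 0
  occurrences-∉ {vs = []} x∉ = refl
  occurrences-∉ {x = x} {v ∷ vs} x∉ rewrite dec-false (x ≟ v) (λ x≡v → x∉ (here x≡v)) =
    occurrences-∉ (λ x∈ → x∉ (there x∈))

  occurrences-∈ : ∀ {n} {x : Fin n} {vs} → x ∈ vs → 1 ≤ occurrences vs x
  occurrences-∈ {x = x} {v ∷ vs} (here x≡v) rewrite dec-true (x ≟ v) x≡v = s≤s z≤n
  occurrences-∈ {x = x} {v ∷ vs} (there x∈) = ℕ.≤-trans (occurrences-∈ x∈) (ℕ.m≤n+m _ [ does (x ≟ v) ])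

  occurrences-unique : ∀ {n} {vs} → Unique vs → (x : Fin n) → occurrences vs x ≤ 1
  occurrences-unique [] x = z≤n
  occurrences-unique {vs = v ∷ vs} (v∉vs ∷ unique) x with x ≟ v
  ... | yes refl = ℕ.≤-reflexive (cong suc (occurrences-∉ (All¬⇒¬Any v∉vs)))
  ... | no _ = occurrences-unique unique x

  length+∣b∣≤n : ∀ {n} (b : Fin n → Bool) {vs} → Unique vs → All (λ v → b v ≡ false) vs →
                 length vs + ∣ b ∣ ≤ n
  length+∣b∣≤n {n} b {vs} unique false-on-vs = begin
    length vs + ∣ b ∣                ≡⟨ cong (_+ ∣ b ∣) (≡.sym (sum-occurrences≡length vs)) ⟩
    sum (occurrences vs) + ∣ b ∣             ≡⟨ ≡.sym (sum-distrib-+ (occurrences vs) _) ⟩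
    sum (λ x → occurrences vs x + [ b x ])   ≤⟨ sum-mono-≤ pointwise ⟩
    sum {n} (λ _ → 1)                ≡⟨ sum-one ⟩
    n                                ∎
    where
    open ℕ.≤-Reasoning
    pointwise : ∀ x → occurrences vs x + [ b x ] ≤ 1
    pointwise x with any? (x ≟_) vs
    ... | yes x∈ rewrite All.lookup false-on-vs x∈ = ℕ.≤-trans (ℕ.≤-reflexive (ℕ.+-identityʳ _)) (occurrences-unique unique x)
    ... | no x∉ rewrite occurrences-∉ x∉ = [b]≤1 (b x)

  n≤length+∣b∣ : ∀ {n} (b : Fin n → Bool) vs → (∀ x → x ∉ vs → b x ≡ true) →
                 n ≤ length vs + ∣ b ∣
  n≤length+∣b∣ {n} b vs true-off-vs = begin
    n                                ≡⟨ ≡.sym (sum-one {n}) ⟩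
    sum {n} (λ _ → 1)                ≤⟨ sum-mono-≤ pointwise ⟩
    sum (λ x → occurrences vs x + [ b x ])   ≡⟨ sum-distrib-+ (occurrences vs) _ ⟩
    sum (occurrences vs) + ∣ b ∣             ≡⟨ cong (_+ ∣ b ∣) (sum-occurrences≡length vs) ⟩
    length vs + ∣ b ∣                ∎
    where
    open ℕ.≤-Reasoning
    pointwise : ∀ x → 1 ≤ occurrences vs x + [ b x ]
    pointwise x with any? (x ≟_) vs
    ... | yes x∈ = ℕ.≤-trans (occurrences-∈ x∈) (ℕ.m≤m+n _ [ b x ])
    ... | no x∉ rewrite occurrences-∉ x∉ | true-off-vs x x∉ = s≤s z≤n

  <⇒≤∸1 : ∀ {m n} → m < n → m ≤ n ∸ 1
  <⇒≤∸1 (s≤s m≤n) = m≤n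

  <ᵇ-true : ∀ {m n} → m < n → (m <ᵇ n) ≡ true
  <ᵇ-true {zero} {suc n} _ = refl
  <ᵇ-true {suc m} {suc n} (s≤s m<n) = <ᵇ-true m<n

  <ᵇ-true⁻¹ : ∀ {m n} → (m <ᵇ n) ≡ true → m < n
  <ᵇ-true⁻¹ {zero} {suc n} _ = s≤s z≤n
  <ᵇ-true⁻¹ {suc m} {suc n} m<n = s≤s (<ᵇ-true⁻¹ m<n)

  <ᵇ-false : ∀ {m n} → n ≤ m → (m <ᵇ n) ≡ false
  <ᵇ-false {m} {zero} _ = refl
  <ᵇ-false {suc m} {suc n} (s≤s n≤m) = <ᵇ-false n≤m

  <ᵇ-false⇒≥ : ∀ m n → (m <ᵇ n) ≡ false → n ≤ m
  <ᵇ-false⇒≥ m zero _ = z≤n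
  <ᵇ-false⇒≥ (suc m) (suc n) eq = s≤s (<ᵇ-false⇒≥ m n eq)

  <ᵇ-suc : ∀ m k → m ≢ k → (m <ᵇ suc k) ≡ (m <ᵇ k)
  <ᵇ-suc zero zero m≢k = ⊥-elim (m≢k refl)
  <ᵇ-suc zero (suc k) _ = refl
  <ᵇ-suc (suc m) zero _ = refl
  <ᵇ-suc (suc m) (suc k) m≢k = <ᵇ-suc m k (λ m≡k → m≢k (cong suc m≡k))

  transpose-i : ∀ {n} (i j : Fin n) → transpose i j ⟨$⟩ʳ i ≡ j
  transpose-i i j rewrite dec-true (i ≟ i) refl = refl

  transpose-j : ∀ {n} (i j : Fin n) → transpose i j ⟨$⟩ʳ j ≡ i
  transpose-j i j with j ≟ i
  ... | yes j≡i = j≡i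
  ... | no _ rewrite dec-true (j ≟ j) refl = refl

  transpose-other : ∀ {n} {i j k : Fin n} → k ≢ i → k ≢ j → transpose i j ⟨$⟩ʳ k ≡ k
  transpose-other {i = i} {j} {k} k≢i k≢j rewrite dec-false (k ≟ i) k≢i | dec-false (k ≟ j) k≢j = refl

  Sorted : ∀ {m} → (Fin m → Bool) → ℕ → Permutation m m → Set
  Sorted b k π = ∀ i → b (π ⟨$⟩ʳ i) ≡ (toℕ i <ᵇ k)

  sinkFalseHead : ∀ {m} (b : Fin (suc m) → Bool) (σ : Permutation (suc m) (suc m)) {k} → k ≤ m →
    b (σ ⟨$⟩ʳ 0F) ≡ false → (∀ i → b (σ ⟨$⟩ʳ sucF i) ≡ (toℕ i <ᵇ k)) →
    Σ[ π ∈ Permutation (suc m) (suc m) ] Sorted b k π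
  sinkFalseHead b σ {zero} _ head-false tail-sorted = σ , λ { 0F → head-false ; (sucF i) → tail-sorted i }
  sinkFalseHead {m} b σ {suc k} k<m head-false tail-sorted = transpose 0F K ∘ₚ σ , sorted
    where
    K : Fin (suc m)
    K = sucF (fromℕ< k<m)
    sorted : Sorted b (suc k) (transpose 0F K ∘ₚ σ)
    sorted 0F rewrite transpose-i 0F K | tail-sorted (fromℕ< k<m) | toℕ-fromℕ< k<m = <ᵇ-true (ℕ.n<1+n k)
    sorted (sucF i) with sucF i ≟ K
    ... | yes refl rewrite transpose-j 0F K | toℕ-fromℕ< k<m = trans head-false (≡.sym (<ᵇ-false (ℕ.≤-refl {k})))
    ... | no i≢K = begin
      b (σ ⟨$⟩ʳ (transpose 0F K ⟨$⟩ʳ sucF i))  ≡⟨ cong (λ x → b (σ ⟨$⟩ʳ x)) (transpose-other {i = 0F} {K} (λ ()) i≢K) ⟩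
      b (σ ⟨$⟩ʳ sucF i)                        ≡⟨ tail-sorted i ⟩
      toℕ i <ᵇ suc k                           ≡⟨ <ᵇ-suc (toℕ i) k i≢k ⟩
      toℕ i <ᵇ k                               ∎
      where
      open ≡-Reasoning
      i≢k : toℕ i ≢ k
      i≢k i≡k = i≢K (cong sucF (toℕ-injective (trans i≡k (≡.sym (toℕ-fromℕ< k<m)))))

  sortTrueFirst : ∀ {m} (b : Fin m → Bool) → Σ[ π ∈ Permutation m m ] Sorted b ∣ b ∣ π
  sortTrueFirst {zero} b = Perm.id , λ ()
  sortTrueFirst {suc m} b with sortTrueFirst (λ i → b (sucF i))
  ... | π , tail-sorted with b 0F in head
  ...   | true = lift₀ π , λ { 0F → head ; (sucF i) → tail-sorted i }
  ...   | false = sinkFalseHead b (lift₀ π) (∣b∣≤n (λ i → b (sucF i))) head tail-sorted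

  Sorted-transpose : ∀ {m} {b : Fin m → Bool} {k π} (i j : Fin m) → Sorted b k π →
    (toℕ i <ᵇ k) ≡ (toℕ j <ᵇ k) → Sorted b k (transpose i j ∘ₚ π)
  Sorted-transpose {b = b} {k} {π} i j sorted same l = cases l (l ≟ i) (l ≟ j)
    where
    at : ∀ l {x} → transpose i j ⟨$⟩ʳ l ≡ x → b ((transpose i j ∘ₚ π) ⟨$⟩ʳ l) ≡ b (π ⟨$⟩ʳ x)
    at _ = cong (λ x → b (π ⟨$⟩ʳ x))
    cases : ∀ l → Dec (l ≡ i) → Dec (l ≡ j) → b ((transpose i j ∘ₚ π) ⟨$⟩ʳ l) ≡ (toℕ l <ᵇ k)
    cases l (yes refl) _ = trans (at l (transpose-i l j)) (trans (sorted j) (≡.sym same))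
    cases l (no _) (yes refl) = trans (at l (transpose-j i l)) (trans (sorted i) same)
    cases l (no l≢i) (no l≢j) = trans (at l (transpose-other l≢i l≢j)) (sorted l)

  sortPlacingLast : ∀ {m} (b : Fin (suc m) → Bool) {w} → b w ≡ false →
    Σ[ ρ ∈ Permutation (suc m) (suc m) ] (ρ ⟨$⟩ʳ fromℕ m ≡ w × Sorted b ∣ b ∣ ρ)
  sortPlacingLast {m} b {w} bw≡false =
    transpose (fromℕ m) p ∘ₚ π , last↦w , Sorted-transpose {b = b} {k = ∣ b ∣} {π = π} (fromℕ m) p sorted last≡p
    where
    π : Permutation (suc m) (suc m)
    π = proj₁ (sortTrueFirst b)
    sorted : Sorted b ∣ b ∣ π
    sorted = proj₂ (sortTrueFirst b)
    p : Fin (suc m)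
    p = π ⟨$⟩ˡ w
    p-false : (toℕ p <ᵇ ∣ b ∣) ≡ false
    p-false = trans (≡.sym (sorted p)) (trans (cong b (Perm.inverseʳ π)) bw≡false)
    last≡p : (toℕ (fromℕ m) <ᵇ ∣ b ∣) ≡ (toℕ p <ᵇ ∣ b ∣)
    last≡p = trans (<ᵇ-false {toℕ (fromℕ m)} (ℕ.≤-trans (<ᵇ-false⇒≥ (toℕ p) ∣ b ∣ p-false)
                               (subst (toℕ p ≤_) (≡.sym (toℕ-fromℕ m)) (toℕ≤pred[n] p))))
                   (≡.sym p-false)
    last↦w : (transpose (fromℕ m) p ∘ₚ π) ⟨$⟩ʳ fromℕ m ≡ w
    last↦w rewrite transpose-i (fromℕ m) p = Perm.inverseʳ π

module Degrees where
  open Counting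
  open import Data.Nat using (zero; _+_; _≤_; _<_)
  open import Data.Bool using (Bool; true; false)
  open import Data.Fin using (Fin) renaming (zero to 0F; suc to sucF)
  open import Data.Fin.Permutation using (Permutation; _⟨$⟩ʳ_)
  open import Data.List using (length; tabulate)
  open import Data.List.Relation.Unary.Unique.Propositional using (Unique)
  open import Data.List.Membership.Propositional using (_∉_)
  open import Data.List.Relation.Unary.All using (All; []; _∷_)
  open import Data.List.Relation.Unary.AllPairs using ([]; _∷_)
  open import Function.Bundles using (Injection; _↔_; Inverse)
  open Inverse using (to)
  open import Function.Properties.Inverse using (↔⇒↣)
  open import Relation.Binary.PropositionalEquality as ≡ using (_≡_; _≢_; refl; trans; cong; subst; module ≡-Reasoning)

  count-tabulate : ∀ {A : Set} {n} (p : A → Bool) (g : Fin n → A) → count p (tabulate g) ≡ ∣ (λ i → p (g i)) ∣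
  count-tabulate {n = zero} p g = refl
  count-tabulate {n = suc n} p g with p (g 0F)
  ... | true = cong suc (count-tabulate p (λ i → g (sucF i)))
  ... | false = count-tabulate p (λ i → g (sucF i))

  degree≡∣adj∣ : ∀ {n} (G : Graph n) u → degree G u ≡ ∣ adj G u ∣
  degree≡∣adj∣ G u = count-tabulate (adj G u) (λ v → v)

  length+degree≤n : ∀ {n} (G : Graph n) u {vs} → Unique vs → All (λ v → adj G u v ≡ false) vs →
                   length vs + degree G u ≤ n
  length+degree≤n {n} G u {vs} unique non-adjacent =
    subst (λ d → length vs + d ≤ n) (≡.sym (degree≡∣adj∣ G u)) (length+∣b∣≤n (adj G u) unique non-adjacent)

  n≤length+degree : ∀ {n} (G : Graph n) u vs → (∀ x → x ∉ vs → adj G u x ≡ true) →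
                    n ≤ length vs + degree G u
  n≤length+degree G u vs adjacent =
    subst (λ d → _ ≤ length vs + d) (≡.sym (degree≡∣adj∣ G u)) (n≤length+∣b∣ (adj G u) vs adjacent)

  degree<n : ∀ {n} (G : Graph n) u → degree G u < n
  degree<n G u = length+degree≤n G u ([] ∷ []) (irrefl G u ∷ [])

  degree-permute : ∀ {n} (G : Graph n) u (ρ : Permutation n n) → degree G u ≡ ∣ (λ i → adj G u (ρ ⟨$⟩ʳ i)) ∣
  degree-permute G u ρ = trans (degree≡∣adj∣ G u) (sum-permute _ ρ)

  degree-≅ : ∀ {n} {G G′ : Graph n} (f : Fin n ↔ Fin n) → (∀ i j → adj G i j ≡ adj G′ (to f i) (to f j)) →
             ∀ i → degree G i ≡ degree G′ (to f i)
  degree-≅ {G = G} {G′} f adj-preserved i = begin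
    degree G i                           ≡⟨ degree≡∣adj∣ G i ⟩
    ∣ adj G i ∣                           ≡⟨ sum-cong-≗ (λ j → cong [_] (adj-preserved i j)) ⟩
    ∣ (λ j → adj G′ (to f i) (to f j)) ∣  ≡⟨ ≡.sym (degree-permute G′ (to f i) f) ⟩
    degree G′ (to f i)                   ∎
    where open ≡-Reasoning

  permute-≢ : ∀ {n} (ρ : Permutation n n) {i j} → i ≢ j → ρ ⟨$⟩ʳ i ≢ ρ ⟨$⟩ʳ j
  permute-≢ ρ i≢j ρi≡ρj = i≢j (Injection.injective (↔⇒↣ ρ) ρi≡ρj)

module ExtremalGraph {δ Δ : ℕ} (δ<Δ : δ <ℕ Δ) where
  open Counting
  open Degrees
  open import Data.Nat using (_+_; _≤_; _<_; z≤n; s≤s; _<ᵇ_; _≡ᵇ_)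
  import Data.Nat.Properties as ℕ
  open import Data.Bool using (true; false; not)
  open import Data.Bool.Properties using (∧-zeroʳ)
  open import Data.Fin using (Fin; toℕ; fromℕ) renaming (zero to 0F)
  open import Data.Fin.Properties using (_≟_; toℕ-injective; toℕ-fromℕ; toℕ≤pred[n])
  open import Data.Fin.Permutation as Perm using (Permutation; _⟨$⟩ʳ_; _⟨$⟩ˡ_)
  open import Data.List using ([]; _∷_)
  open import Data.List.Relation.Unary.All using ([]; _∷_)
  open import Data.List.Relation.Unary.Any using (here; there)
  open import Data.List.Membership.Propositional using (_∈_)
  open import Data.List.Relation.Unary.AllPairs using ([]; _∷_)
  open import Data.Product using (Σ-syntax)
  open import Data.Empty using (⊥-elim)
  open import Relation.Nullary using (Dec; yes; no; ¬_)
  open import Relation.Nullary.Decidable using (dec-true; dec-false)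
  open import Relation.Binary.PropositionalEquality as ≡ using (_≡_; _≢_; refl; trans; cong; cong₂; subst; module ≡-Reasoning)

  w : Fin (suc Δ)
  w = fromℕ Δ

  ≡ᵇ-refl : ∀ m → (m ≡ᵇ m) ≡ true
  ≡ᵇ-refl m = dec-true (m ℕ.≟ m) refl

  ≡ᵇ-false : ∀ {m n} → m ≢ n → (m ≡ᵇ n) ≡ false
  ≡ᵇ-false {m} {n} = dec-false (m ℕ.≟ n)

  toℕ<Δ : ∀ {u} → u ≢ w → toℕ u < Δ
  toℕ<Δ {u} u≢w = ℕ.≤∧≢⇒< (toℕ≤pred[n] u) (λ u≡Δ → u≢w (toℕ-injective (trans u≡Δ (≡.sym (toℕ-fromℕ Δ)))))

  adjH-w : ∀ j → adjH δ Δ w j ≡ (toℕ j <ᵇ δ)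
  adjH-w j rewrite toℕ-fromℕ Δ | <ᵇ-false {Δ} {Δ} ℕ.≤-refl | ≡ᵇ-refl Δ | <ᵇ-false {Δ} {δ} (ℕ.<⇒≤ δ<Δ)
    with toℕ j <ᵇ δ in j<δ
  ... | true rewrite ≡ᵇ-false {Δ} {toℕ j} (λ Δ≡j → ℕ.<-asym δ<Δ (subst (_< δ) (≡.sym Δ≡j) (<ᵇ-true⁻¹ j<δ))) = refl
  ... | false rewrite ∧-zeroʳ (toℕ j ≡ᵇ Δ) = ∧-zeroʳ (not (Δ ≡ᵇ toℕ j))

  adjH-clique : ∀ {u v} → u ≢ w → v ≢ w → u ≢ v → adjH δ Δ u v ≡ true
  adjH-clique {u} {v} u≢w v≢w u≢v
    rewrite ≡ᵇ-false (λ u≡v → u≢v (toℕ-injective u≡v)) | <ᵇ-true (toℕ<Δ u≢w) | <ᵇ-true (toℕ<Δ v≢w) = refl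

  degreeH-w : degree (H δ Δ) w ≡ δ
  degreeH-w = begin
    degree (H δ Δ) w               ≡⟨ degree≡∣adj∣ (H δ Δ) w ⟩
    ∣ adjH δ Δ w ∣                 ≡⟨ sum-cong-≗ (λ j → cong [_] (adjH-w j)) ⟩
    ∣ (λ (j : Fin (suc Δ)) → toℕ j <ᵇ δ) ∣ ≡⟨ ∣<k∣≡k {suc Δ} δ (ℕ.m≤n⇒m≤1+n (ℕ.<⇒≤ δ<Δ)) ⟩
    δ                              ∎
    where open ≡-Reasoning

  degreeH-neighbour : ∀ {u} → adjH δ Δ w u ≡ true → degree (H δ Δ) u ≡ Δ
  degreeH-neighbour {u} wu = ℕ.≤-antisym (ℕ.≤-pred (degree<n (H δ Δ) u))
    (ℕ.≤-pred (n≤length+degree (H δ Δ) u (u ∷ []) adjacent))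
    where
    u≢w : u ≢ w
    u≢w refl with () ← trans (≡.sym wu) (irrefl (H δ Δ) w)
    adjacent : ∀ x → ¬ (x ∈ u ∷ []) → adjH δ Δ u x ≡ true
    adjacent x x∉ with x ≟ w
    ... | yes refl = trans (Graph.sym (H δ Δ) u w) wu
    ... | no x≢w = adjH-clique u≢w x≢w (λ u≡x → x∉ (here (≡.sym u≡x)))

  degreeH-nonNeighbour : ∀ {u} → u ≢ w → adjH δ Δ w u ≡ false → degree (H δ Δ) u ≡ Δ ∸ 1
  degreeH-nonNeighbour {u} u≢w wu = cong (_∸ 1) (ℕ.suc-injective (ℕ.≤-antisym
    (length+degree≤n (H δ Δ) u ((u≢w ∷ []) ∷ [] ∷ []) (irrefl (H δ Δ) u ∷ trans (Graph.sym (H δ Δ) u w) wu ∷ []))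
    (n≤length+degree (H δ Δ) u (u ∷ w ∷ []) adjacent)))
    where
    adjacent : ∀ x → ¬ (x ∈ u ∷ w ∷ []) → adjH δ Δ u x ≡ true
    adjacent x x∉ = adjH-clique u≢w (λ x≡w → x∉ (there (here x≡w))) (λ u≡x → x∉ (here (≡.sym u≡x)))

  H-inFamily : 1 ≤ δ → InFamily (suc Δ) δ Δ (H δ Δ)
  H-inFamily 1≤δ = δ≤degree , (w , degreeH-w) , (λ u → ℕ.≤-pred (degree<n (H δ Δ) u)) ,
                   (0F , degreeH-neighbour (trans (adjH-w 0F) (<ᵇ-true 1≤δ)))
    where
    δ≤degree : ∀ u → δ ≤ degree (H δ Δ) u
    δ≤degree u with u ≟ w | adjH δ Δ w u in wu
    ... | yes refl | _ = ℕ.≤-reflexive (≡.sym degreeH-w)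
    ... | no _ | true = subst (δ ≤_) (≡.sym (degreeH-neighbour wu)) (ℕ.<⇒≤ δ<Δ)
    ... | no u≢w | false = subst (δ ≤_) (≡.sym (degreeH-nonNeighbour u≢w wu)) (<⇒≤∸1 δ<Δ)

  Aligned : Graph (suc Δ) → Permutation (suc Δ) (suc Δ) → Set
  Aligned G ρ = ∀ i → adj G (ρ ⟨$⟩ʳ w) (ρ ⟨$⟩ʳ i) ≡ adjH δ Δ w i

  aligned-exists : ∀ (G : Graph (suc Δ)) {v} → degree G v ≡ δ → Σ[ ρ ∈ Permutation (suc Δ) (suc Δ) ] Aligned G ρ
  aligned-exists G {v} degree≡δ with sortPlacingLast (adj G v) (irrefl G v)
  ... | ρ , ρw≡v , sorted = ρ , λ i → begin
    adj G (ρ ⟨$⟩ʳ w) (ρ ⟨$⟩ʳ i)  ≡⟨ cong (λ x → adj G x (ρ ⟨$⟩ʳ i)) ρw≡v ⟩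
    adj G v (ρ ⟨$⟩ʳ i)           ≡⟨ sorted i ⟩
    toℕ i <ᵇ ∣ adj G v ∣          ≡⟨ cong (toℕ i <ᵇ_) (trans (≡.sym (degree≡∣adj∣ G v)) degree≡δ) ⟩
    toℕ i <ᵇ δ                   ≡⟨ ≡.sym (adjH-w i) ⟩
    adjH δ Δ w i                 ∎
    where open ≡-Reasoning

  module _ {G : Graph (suc Δ)} {ρ : Permutation (suc Δ) (suc Δ)} (aligned : Aligned G ρ) where

    aligned-degree-w : degree G (ρ ⟨$⟩ʳ w) ≡ degree (H δ Δ) w
    aligned-degree-w = begin
      degree G (ρ ⟨$⟩ʳ w)                        ≡⟨ degree-permute G (ρ ⟨$⟩ʳ w) ρ ⟩
      ∣ (λ i → adj G (ρ ⟨$⟩ʳ w) (ρ ⟨$⟩ʳ i)) ∣    ≡⟨ sum-cong-≗ (λ i → cong [_] (aligned i)) ⟩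
      ∣ adjH δ Δ w ∣                             ≡⟨ ≡.sym (degree≡∣adj∣ (H δ Δ) w) ⟩
      degree (H δ Δ) w                           ∎
      where open ≡-Reasoning

    non-adjacent-to-w : ∀ {i} → adjH δ Δ w i ≡ false → adj G (ρ ⟨$⟩ʳ i) (ρ ⟨$⟩ʳ w) ≡ false
    non-adjacent-to-w {i} wi = trans (Graph.sym G _ _) (trans (aligned i) wi)

    aligned-degree-≤ : (∀ u → degree G u ≤ Δ) → ∀ i → degree G (ρ ⟨$⟩ʳ i) ≤ degree (H δ Δ) i
    aligned-degree-≤ ≤Δ i with i ≟ w | adjH δ Δ w i in wi
    ... | yes refl | _ = ℕ.≤-reflexive aligned-degree-w
    ... | no _ | true = subst (degree G (ρ ⟨$⟩ʳ i) ≤_) (≡.sym (degreeH-neighbour wi)) (≤Δ (ρ ⟨$⟩ʳ i))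
    ... | no i≢w | false = subst (degree G (ρ ⟨$⟩ʳ i) ≤_) (≡.sym (degreeH-nonNeighbour i≢w wi))
      (<⇒≤∸1 (ℕ.≤-pred (length+degree≤n G (ρ ⟨$⟩ʳ i) ((permute-≢ ρ i≢w ∷ []) ∷ [] ∷ [])
                                          (irrefl G _ ∷ non-adjacent-to-w wi ∷ []))))

    module _ (same-degrees : ∀ i → i ≢ w → degree G (ρ ⟨$⟩ʳ i) ≡ degree (H δ Δ) i) where

      aligned-clique : ∀ {i j} → i ≢ w → j ≢ w → i ≢ j → adj G (ρ ⟨$⟩ʳ i) (ρ ⟨$⟩ʳ j) ≡ true
      -- Otherwise ρ i misses itself and ρ j, and also ρ w when i is not a neighbour of w in H.
      aligned-clique {i} {j} i≢w j≢w i≢j with adj G (ρ ⟨$⟩ʳ i) (ρ ⟨$⟩ʳ j) in ij | adjH δ Δ w i in wi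
      ... | true | _ = refl
      ... | false | true = ⊥-elim (ℕ.<-irrefl refl (subst (λ d → 2 + d ≤ suc Δ)
            (trans (same-degrees i i≢w) (degreeH-neighbour wi))
            (length+degree≤n G _ ((permute-≢ ρ i≢j ∷ []) ∷ [] ∷ []) (irrefl G _ ∷ ij ∷ []))))
      ... | false | false = ⊥-elim (no-room (ℕ.<-≤-trans (s≤s z≤n) δ<Δ) (subst (λ d → 3 + d ≤ suc Δ)
            (trans (same-degrees i i≢w) (degreeH-nonNeighbour i≢w wi))
            (length+degree≤n G _ ((permute-≢ ρ i≢j ∷ permute-≢ ρ i≢w ∷ []) ∷ (permute-≢ ρ j≢w ∷ []) ∷ [] ∷ [])
                                (irrefl G _ ∷ ij ∷ non-adjacent-to-w wi ∷ []))))
        where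
        no-room : ∀ {n} → 1 ≤ n → ¬ (3 + (n ∸ 1) ≤ suc n)
        no-room {suc n} _ (s≤s (s≤s n<n)) = ℕ.<-irrefl refl n<n

      aligned-adj : ∀ i j → adj G (ρ ⟨$⟩ʳ i) (ρ ⟨$⟩ʳ j) ≡ adjH δ Δ i j
      aligned-adj i j = cases i j (i ≟ j) (i ≟ w) (j ≟ w)
        where
        cases : ∀ i j → Dec (i ≡ j) → Dec (i ≡ w) → Dec (j ≡ w) → adj G (ρ ⟨$⟩ʳ i) (ρ ⟨$⟩ʳ j) ≡ adjH δ Δ i j
        cases i _ (yes refl) _ _ = trans (irrefl G _) (≡.sym (irrefl (H δ Δ) i))
        cases _ j (no _) (yes refl) _ = aligned j
        cases i _ (no _) (no _) (yes refl) = trans (Graph.sym G _ _) (trans (aligned i) (Graph.sym (H δ Δ) w i))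
        cases i j (no i≢j) (no i≢w) (no j≢w) = trans (aligned-clique i≢w j≢w i≢j) (≡.sym (adjH-clique i≢w j≢w i≢j))

      aligned-≅ : G ≅ H δ Δ
      aligned-≅ = Perm.flip ρ , λ i j →
        trans (cong₂ (adj G) (≡.sym (Perm.inverseʳ ρ)) (≡.sym (Perm.inverseʳ ρ))) (aligned-adj (ρ ⟨$⟩ˡ i) (ρ ⟨$⟩ˡ j))

module OrderedSums {c ℓ} (R : OrderedAbelianGroup c ℓ) where
  open OrderedAbelianGroup R
  open import Data.Nat using (zero)
  open import Data.Fin using (Fin) renaming (zero to 0F; suc to sucF)
  open import Data.List using (map; tabulate)
  open import Algebra.Bundles using (CommutativeMonoid)
  open import Algebra.Consequences.Propositional {A = Carrier} using (comm∧idˡ⇒idʳ; comm∧invˡ⇒invʳ)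
  open import Relation.Binary.PropositionalEquality as ≡ using (_≡_; refl; cong; cong₂; subst₂; module ≡-Reasoning)
  import Algebra.Properties.CommutativeMonoid.Sum as CommutativeMonoidSum
  open import Relation.Binary.Bundles using (Preorder)
  import Relation.Binary.Reasoning.Preorder
  open import Data.Vec.Functional using (removeAt)
  open import Data.Fin using (punchIn)

  +-identityʳ : ∀ x → x + 0# ≡ x
  +-identityʳ = comm∧idˡ⇒idʳ +-comm +-identityˡ

  +-commutativeMonoid : CommutativeMonoid c c
  +-commutativeMonoid = record
    { isCommutativeMonoid = record
      { isMonoid = record
        { isSemigroup = record
          { isMagma = record { isEquivalence = ≡.isEquivalence ; ∙-cong = cong₂ _+_ }
          ; assoc = +-assoc }
        ; identity = +-identityˡ , +-identityʳ }
      ; comm = +-comm } }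

  open CommutativeMonoidSum +-commutativeMonoid public using (sum; sum-cong-≗; sum-permute; sum-remove)

  sumL-map-tabulate : ∀ {A : Set} {n} (f : A → Carrier) (g : Fin n → A) →
                      sumL (map f (tabulate g)) ≡ sum (λ i → f (g i))
  sumL-map-tabulate {n = zero} f g = refl
  sumL-map-tabulate {n = suc n} f g = cong (f (g 0F) +_) (sumL-map-tabulate f (λ i → g (sucF i)))

  +-monoʳ-≤ : ∀ {x y} z → x ≤ y → z + x ≤ z + y
  +-monoʳ-≤ {x} {y} z x≤y = subst₂ _≤_ (+-comm x z) (+-comm y z) (+-monoˡ-≤ z x≤y)

  +-mono-≤ : ∀ {x y u v} → x ≤ y → u ≤ v → x + u ≤ y + v
  +-mono-≤ {y = y} {u} x≤y u≤v = ≤-trans (+-monoˡ-≤ u x≤y) (+-monoʳ-≤ y u≤v)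

  +-cancelʳ-≤ : ∀ {x y} z → x + z ≤ y + z → x ≤ y
  +-cancelʳ-≤ {x} {y} z x+z≤y+z = subst₂ _≤_ (cancel x) (cancel y) (+-monoˡ-≤ (- z) x+z≤y+z)
    where
    cancel : ∀ u → (u + z) + - z ≡ u
    cancel u = begin
      (u + z) + - z  ≡⟨ +-assoc u z (- z) ⟩
      u + (z + - z)  ≡⟨ cong (u +_) (comm∧invˡ⇒invʳ +-comm -‿inverseˡ z) ⟩
      u + 0#         ≡⟨ +-identityʳ u ⟩
      u              ∎
      where open ≡-Reasoning

  ≤-preorder : Preorder c c ℓ
  ≤-preorder = record
    { Carrier = Carrier ; _≈_ = _≡_ ; _≲_ = _≤_
    ; isPreorder = record
      { isEquivalence = ≡.isEquivalence ; reflexive = λ { refl → ≤-refl } ; trans = ≤-trans } }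

  module ≤-Reasoning = Relation.Binary.Reasoning.Preorder ≤-preorder

  sum-mono-≤ : ∀ {n} {f g : Fin n → Carrier} → (∀ i → f i ≤ g i) → sum f ≤ sum g
  sum-mono-≤ {zero} f≤g = ≤-refl
  sum-mono-≤ {suc n} f≤g = +-mono-≤ (f≤g 0F) (sum-mono-≤ (λ i → f≤g (sucF i)))

  sum-mono-≤-tight : ∀ {n} {f g : Fin n → Carrier} → (∀ i → f i ≤ g i) → sum g ≤ sum f → ∀ i → f i ≡ g i
  sum-mono-≤-tight {suc n} {f} {g} f≤g g≤f i = ≤-antisym (f≤g i) (+-cancelʳ-≤ (sum (removeAt f i)) (begin
      g i + sum (removeAt f i)  ≲⟨ +-monoʳ-≤ (g i) (sum-mono-≤ (λ j → f≤g (punchIn i j))) ⟩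
      g i + sum (removeAt g i)  ≡⟨ ≡.sym (sum-remove g) ⟩
      sum g                     ≲⟨ g≤f ⟩
      sum f                     ≡⟨ sum-remove f ⟩
      f i + sum (removeAt f i)  ∎))
    where open ≤-Reasoning

module Minimality {c ℓ} (R : OrderedAbelianGroup c ℓ) {δ Δ : ℕ} (1≤δ : 1 ≤ℕ δ) (δ<Δ : δ <ℕ Δ)
  (h : ℕ → OrderedAbelianGroup.Carrier R)
  (h-antitone : ∀ a b → 1 ≤ℕ a → a ≤ℕ b → OrderedAbelianGroup._≤_ R (h b) (h a)) where
  open OrderedAbelianGroup R
  open OrderedSums R
  open Counting using (<⇒≤∸1)
  open Degrees using (degree-≅; degree-permute)
  open ExtremalGraph δ<Δ
  import Data.Nat.Properties as ℕ
  open import Data.Bool using (true; false)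
  open import Data.Fin.Permutation using (Permutation; _⟨$⟩ʳ_)
  open import Data.Product using (proj₁; proj₂)
  open import Data.Empty using (⊥-elim)
  open import Function.Bundles using (mk⇔; Inverse)
  open import Relation.Nullary using (yes; no)
  open import Relation.Binary.PropositionalEquality as ≡ using (_≡_; _≢_; trans; cong; subst; subst₂; module ≡-Reasoning)

  𝒥≡sum : ∀ {n} (G : Graph n) → 𝒥 R h G ≡ sum (λ u → h (degree G u))
  𝒥≡sum G = sumL-map-tabulate (λ u → h (degree G u)) (λ u → u)

  𝒥-permute : ∀ {n} (G : Graph n) (ρ : Permutation n n) → 𝒥 R h G ≡ sum (λ i → h (degree G (ρ ⟨$⟩ʳ i)))
  𝒥-permute G ρ = trans (𝒥≡sum G) (sum-permute _ ρ)

  𝒥-≅ : ∀ {n} {G G′ : Graph n} → G ≅ G′ → 𝒥 R h G ≡ 𝒥 R h G′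
  𝒥-≅ {G = G} {G′} (f , adj-preserved) = begin
    𝒥 R h G                                   ≡⟨ 𝒥≡sum G ⟩
    sum (λ i → h (degree G i))                ≡⟨ sum-cong-≗ (λ i → cong h (degree-≅ {G = G} {G′} f adj-preserved i)) ⟩
    sum (λ i → h (degree G′ (Inverse.to f i))) ≡⟨ ≡.sym (𝒥-permute G′ f) ⟩
    𝒥 R h G′                                  ∎
    where open ≡-Reasoning

  ≡-at-drop : ∀ {d e} → 1 ≤ℕ d → d ≤ℕ e → h e ≢ h (e ∸ 1) → h d ≡ h e → d ≡ e
  ≡-at-drop {d} {e} 1≤d d≤e drop hd≡he with d ℕ.≟ e
  ... | yes d≡e = d≡e
  ... | no d≢e = ⊥-elim (drop (≤-antisym (h-antitone (e ∸ 1) e 1≤e∸1 (ℕ.m∸n≤m e 1))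
                                         (subst (h (e ∸ 1) ≤_) hd≡he (h-antitone d (e ∸ 1) 1≤d d≤e∸1))))
    where
    d≤e∸1 : d ≤ℕ e ∸ 1
    d≤e∸1 = <⇒≤∸1 (ℕ.≤∧≢⇒< d≤e d≢e)
    1≤e∸1 : 1 ≤ℕ e ∸ 1
    1≤e∸1 = ℕ.≤-trans 1≤d d≤e∸1

  module _ {G : Graph (suc Δ)} (inG : InFamily (suc Δ) δ Δ G)
           {ρ : Permutation (suc Δ) (suc Δ)} (aligned : Aligned G ρ) where

    1≤degree : ∀ u → 1 ≤ℕ degree G u
    1≤degree u = ℕ.≤-trans 1≤δ (proj₁ inG u)

    h-degreeH≤h-degree : ∀ i → h (degree (H δ Δ) i) ≤ h (degree G (ρ ⟨$⟩ʳ i))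
    h-degreeH≤h-degree i =
      h-antitone _ _ (1≤degree (ρ ⟨$⟩ʳ i)) (aligned-degree-≤ {G} {ρ} aligned (proj₁ (proj₂ (proj₂ inG))) i)

    𝒥H≤𝒥-aligned : 𝒥 R h (H δ Δ) ≤ 𝒥 R h G
    𝒥H≤𝒥-aligned = subst₂ _≤_ (≡.sym (𝒥≡sum (H δ Δ))) (≡.sym (𝒥-permute G ρ)) (sum-mono-≤ h-degreeH≤h-degree)

    module _ (drop₁ : h (Δ ∸ 1) < h (Δ ∸ 2)) (drop₀ : h Δ < h (Δ ∸ 1))
             (𝒥≤𝒥H : 𝒥 R h G ≤ 𝒥 R h (H δ Δ)) where

      h-degreeH≡h-degree : ∀ i → h (degree (H δ Δ) i) ≡ h (degree G (ρ ⟨$⟩ʳ i))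
      h-degreeH≡h-degree = sum-mono-≤-tight h-degreeH≤h-degree
        (subst₂ _≤_ (𝒥-permute G ρ) (𝒥≡sum (H δ Δ)) 𝒥≤𝒥H)

      drop-below-degreeH : ∀ i → i ≢ w → h (degree (H δ Δ) i) ≢ h (degree (H δ Δ) i ∸ 1)
      drop-below-degreeH i i≢w with adjH δ Δ w i in wi
      ... | true rewrite degreeH-neighbour wi = proj₂ drop₀
      ... | false rewrite degreeH-nonNeighbour i≢w wi | ℕ.∸-+-assoc Δ 1 1 = proj₂ drop₁

      same-degrees : ∀ i → i ≢ w → degree G (ρ ⟨$⟩ʳ i) ≡ degree (H δ Δ) i
      same-degrees i i≢w = ≡-at-drop (1≤degree _) (aligned-degree-≤ {G} {ρ} aligned (proj₁ (proj₂ (proj₂ inG))) i)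
        (drop-below-degreeH i i≢w) (≡.sym (h-degreeH≡h-degree i))

  𝒥H≤𝒥 : ∀ G → InFamily (suc Δ) δ Δ G → 𝒥 R h (H δ Δ) ≤ 𝒥 R h G
  𝒥H≤𝒥 G inG@(_ , (_ , degree≡δ) , _) with aligned-exists G degree≡δ
  ... | ρ , aligned = 𝒥H≤𝒥-aligned {G} inG {ρ} aligned

  H-minimal : IsMinimal R h (suc Δ) δ Δ (H δ Δ)
  H-minimal = H-inFamily 1≤δ , 𝒥H≤𝒥

  module _ (drop₁ : h (Δ ∸ 1) < h (Δ ∸ 2)) (drop₀ : h Δ < h (Δ ∸ 1)) where

    𝒥≤𝒥H⇒≅ : ∀ G → InFamily (suc Δ) δ Δ G → 𝒥 R h G ≤ 𝒥 R h (H δ Δ) → G ≅ H δ Δ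
    𝒥≤𝒥H⇒≅ G inG@(_ , (_ , degree≡δ) , _) 𝒥≤𝒥H with aligned-exists G degree≡δ
    ... | ρ , aligned = aligned-≅ {G} {ρ} aligned (same-degrees {G} inG {ρ} aligned drop₁ drop₀ 𝒥≤𝒥H)

    minimal⇔≅ : ∀ G → InFamily (suc Δ) δ Δ G → IsMinimal R h (suc Δ) δ Δ G ⇔ (G ≅ H δ Δ)
    minimal⇔≅ G inG = mk⇔
      (λ (_ , minimal) → 𝒥≤𝒥H⇒≅ G inG (minimal (H δ Δ) (H-inFamily 1≤δ)))
      (λ G≅H → inG , λ Γ inΓ → subst (_≤ 𝒥 R h Γ) (≡.sym (𝒥-≅ {G = G} {H δ Δ} G≅H)) (𝒥H≤𝒥 Γ inΓ))

theorem2p10 : ∀ {c ℓ} (R : OrderedAbelianGroup c ℓ) →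
    let open OrderedAbelianGroup R in
    (δ Δ : ℕ) → 1 ≤ℕ δ → δ <ℕ Δ →
    (h : ℕ → Carrier) →
    (∀ k → 1 ≤ℕ k → 0# < h k) →
    (∀ a b → 1 ≤ℕ a → a ≤ℕ b → h b ≤ h a) →
    IsMinimal R h (suc Δ) δ Δ (H δ Δ)
    × (h (Δ ∸ 1) < h (Δ ∸ 2) → h Δ < h (Δ ∸ 1) →
       ∀ (G : Graph (suc Δ)) → InFamily (suc Δ) δ Δ G →
       (IsMinimal R h (suc Δ) δ Δ G ⇔ (G ≅ H δ Δ)))
theorem2p10 R δ Δ 1≤δ δ<Δ h _ h-antitone = H-minimal , minimal⇔≅
  where open Minimality R 1≤δ δ<Δ h h-antitone
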